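{- Let $A_k=\{a_1,\dots,a_k\}$ with $1=a_1<a_2<\dots<a_k$ integers, and let $h_0$ be the smallest positive integer $h$ with $n(h)\ge a_k$. Then $n(h+1)\ge n(h)+a_k$ for all integers $h\ge h_0-1$.
   Context: For an integer $h\ge 0$, an integer $x\ge 0$ has an $h$-representation if $x=\sum_{i=1}^k c_ia_i$ with nonnegative integers $c_i$ and $\sum_i c_i\le h$. The $h$-range $n(h)=n(h,A_k)$ is the largest integer $n$ such that every integer $0\le x\le n$ has an $h$-representation. -}

module Defs where

open import Data.Nat using (ℕ; zero; suc; _+_; _*_; _≤_; _<_)
open import Data.Fin using (Fin; zero; suc; fromℕ)
open import Data.Product using (Σ; _×_; ∃)
open import Relation.Nullary using (¬_)
open import Relation.Binary.PropositionalEquality using (_≡_)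
import Data.Fin as F

Σᶠ : (k : ℕ) → (Fin k → ℕ) → ℕ
Σᶠ zero f = 0
Σᶠ (suc k) f = f zero + Σᶠ k (λ i → f (suc i))

-- A_{k} = {a_1 < ... < a_k} with a_1 = 1, given as a : Fin (suc k) → ℕ
-- (index 0 is a_1, index fromℕ k is a_k)
IsBasis : (k : ℕ) → (Fin (suc k) → ℕ) → Set
IsBasis k a = (a zero ≡ 1) × (∀ (i j : Fin (suc k)) → F._<_ i j → a i < a j)

HRep : (k : ℕ) → (Fin (suc k) → ℕ) → ℕ → ℕ → Set
HRep k a h x = Σ (Fin (suc k) → ℕ) λ c →
  (Σᶠ (suc k) c ≤ h) × (Σᶠ (suc k) (λ i → c i * a i) ≡ x)

IsHRange : (k : ℕ) → (Fin (suc k) → ℕ) → ℕ → ℕ → Set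
IsHRange k a h n = (∀ x → x ≤ n → HRep k a h x) × ¬ HRep k a h (suc n)

IsH0 : (k : ℕ) → (Fin (suc k) → ℕ) → ℕ → Set
IsH0 k a h0 = (1 ≤ h0)
  × (Σ ℕ λ n → IsHRange k a h0 n × (a (fromℕ k) ≤ n))
  × (∀ h → 1 ≤ h → h < h0 → ∀ n → IsHRange k a h n → n < a (fromℕ k))

module Submission where

-- Write N = a_k.  Let n = n(h) and n' = n(h+1), and let x ≤ n + N;
-- we show x has an (h+1)-representation, so that n + N ≤ n' by maximality of n'.
--   * If N ≤ x, then x - N ≤ n has an h-representation; adding one copy of the
--     generator a_k to it gives an (h+1)-representation of x.
--   * If x < N, then x ≤ N ≤ n(h0), so x has an h0-representation, and
--     h0 ≤ h + 1 because h0 - 1 ≤ h.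

open import Defs
open import Data.Nat using (ℕ; suc; _+_; _*_; _∸_; _≤_; _<_; _≤?_; s≤s)
open import Data.Nat.Properties
  using ( ≤-trans; <⇒≤; ≰⇒>; +-assoc; +-suc; +-commutativeSemigroup
        ; +-comm; m≤n+m∸n; m+[n∸m]≡n; m≤n+o⇒m∸n≤o)
open import Data.Fin using (Fin; zero; suc; fromℕ)
open import Data.Product using (_,_)
open import Data.Empty using (⊥-elim)
open import Relation.Nullary using (yes; no)
open import Relation.Binary.PropositionalEquality using (_≡_; refl; sym; cong; subst; module ≡-Reasoning)
open import Algebra.Properties.CommutativeSemigroup +-commutativeSemigroup using (x∙yz≈y∙xz)

bumpAt : ∀ {k} → Fin k → (Fin k → ℕ) → Fin k → ℕ
bumpAt zero    c zero    = suc (c zero)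
bumpAt zero    c (suc j) = c (suc j)
bumpAt (suc i) c zero    = c zero
bumpAt (suc i) c (suc j) = bumpAt i (λ j → c (suc j)) j

Σᶠ-bumpAt : ∀ k (i : Fin k) (c : Fin k → ℕ) → Σᶠ k (bumpAt i c) ≡ suc (Σᶠ k c)
Σᶠ-bumpAt (suc k) zero    c = refl
Σᶠ-bumpAt (suc k) (suc i) c = begin
  c zero + Σᶠ k (bumpAt i (λ j → c (suc j)))  ≡⟨ cong (c zero +_) (Σᶠ-bumpAt k i (λ j → c (suc j))) ⟩
  c zero + suc (Σᶠ k (λ j → c (suc j)))       ≡⟨ +-suc (c zero) _ ⟩
  suc (Σᶠ (suc k) c)                          ∎
  where open ≡-Reasoning

Σᶠ-weighted-bumpAt : ∀ k (i : Fin k) (c a : Fin k → ℕ) →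
  Σᶠ k (λ j → bumpAt i c j * a j) ≡ a i + Σᶠ k (λ j → c j * a j)
Σᶠ-weighted-bumpAt (suc k) zero c a = +-assoc (a zero) (c zero * a zero) _
Σᶠ-weighted-bumpAt (suc k) (suc i) c a = begin
  c zero * a zero + Σᶠ k (λ j → bumpAt i c′ j * a′ j)
    ≡⟨ cong (c zero * a zero +_) (Σᶠ-weighted-bumpAt k i c′ a′) ⟩
  c zero * a zero + (a (suc i) + Σᶠ k (λ j → c′ j * a′ j))
    ≡⟨ x∙yz≈y∙xz (c zero * a zero) (a (suc i)) _ ⟩
  a (suc i) + Σᶠ (suc k) (λ j → c j * a j)
    ∎
  where
  open ≡-Reasoning
  c′ a′ : Fin k → ℕ
  c′ j = c (suc j)
  a′ j = a (suc j)

HRep-add : ∀ {k a h x} (i : Fin (suc k)) → HRep k a h x → HRep k a (suc h) (a i + x)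
HRep-add {k} {a} {h} {x} i (c , size≤h , value≡x) =
  bumpAt i c , size≤ , value≡
  where
  open ≡-Reasoning
  size≤ : Σᶠ (suc k) (bumpAt i c) ≤ suc h
  size≤ = subst (_≤ suc h) (sym (Σᶠ-bumpAt (suc k) i c)) (s≤s size≤h)
  value≡ : Σᶠ (suc k) (λ j → bumpAt i c j * a j) ≡ a i + x
  value≡ = begin
    Σᶠ (suc k) (λ j → bumpAt i c j * a j)  ≡⟨ Σᶠ-weighted-bumpAt (suc k) i c a ⟩
    a i + Σᶠ (suc k) (λ j → c j * a j)     ≡⟨ cong (a i +_) value≡x ⟩
    a i + x                                ∎

HRep-mono : ∀ {k a h h' x} → h ≤ h' → HRep k a h x → HRep k a h' x
HRep-mono h≤h' (c , size≤h , value≡x) = c , ≤-trans size≤h h≤h' , value≡x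

cover-extend : ∀ {k a h n} (i : Fin (suc k)) →
  (∀ x → x ≤ n → HRep k a h x) →
  (∀ x → x < a i → HRep k a (suc h) x) →
  ∀ x → x ≤ n + a i → HRep k a (suc h) x
cover-extend {k} {a} {h} {n} i cover-n cover-below x x≤n+aᵢ with a i ≤? x
... | no  aᵢ≰x = cover-below x (≰⇒> aᵢ≰x)
... | yes aᵢ≤x = subst (HRep k a (suc h)) (m+[n∸m]≡n aᵢ≤x) (HRep-add {k} {a} i (cover-n (x ∸ a i) x∸aᵢ≤n))
  where
  x∸aᵢ≤n : x ∸ a i ≤ n
  x∸aᵢ≤n = m≤n+o⇒m∸n≤o x (a i) (subst (x ≤_) (+-comm n (a i)) x≤n+aᵢ)

HRange-maximal : ∀ {k a h n m} → IsHRange k a h n → (∀ x → x ≤ m → HRep k a h x) → m ≤ n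
HRange-maximal {n = n} {m} (_ , suc-n-unrepresentable) cover-m with m ≤? n
... | yes m≤n = m≤n
... | no  m≰n = ⊥-elim (suc-n-unrepresentable (cover-m (suc n) (≰⇒> m≰n)))

theorem1 : (k : ℕ) (a : Fin (suc k) → ℕ) → IsBasis k a →
    (h0 : ℕ) → IsH0 k a h0 →
    (h : ℕ) → h0 ∸ 1 ≤ h →
    (n n' : ℕ) → IsHRange k a h n → IsHRange k a (suc h) n' →
    n + a (fromℕ k) ≤ n'
theorem1 k a _ h0 (_ , (n0 , (cover-n0 , _) , aₖ≤n0) , _) h h0∸1≤h n n' (cover-n , _) range-n' =
  HRange-maximal {k} {a} {suc h} range-n' (cover-extend {k} {a} (fromℕ k) cover-n cover-below-aₖ)
  where
  h0≤1+h : h0 ≤ suc h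
  h0≤1+h = ≤-trans (m≤n+m∸n h0 1) (s≤s h0∸1≤h)

  cover-below-aₖ : ∀ x → x < a (fromℕ k) → HRep k a (suc h) x
  cover-below-aₖ x x<aₖ = HRep-mono {k} {a} h0≤1+h (cover-n0 x (≤-trans (<⇒≤ x<aₖ) aₖ≤n0))
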